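{- Define the formal series $$H_1(x,q,t,v)=\sum_{n\ge1}\sum_{k\ge -n}\sum_{A\in\mathcal{D}_{n-1}}x^{\mathrm{ct}_{ -k}(uAd)}q^{\mathrm{lt}_{ -k}(uAd)}v^k t^n,$$ $$H_2(x,q,t,v)=\sum_{n\ge0}\sum_{r\ge -n}\sum_{B\in\mathcal{D}_{n}}x^{\mathrm{ct}_{r}(B)}q^{\mathrm{lt}_{r}(B)}v^r t^n,$$ $$H_3(x,q,z,y)=\sum_{n\ge1}\sum_{ -n\le r\le n}\sum_{D\in\mathcal{D}_{n}}x^{\mathrm{ct}_{r}(D)}q^{\mathrm{lt}_{r}(D)}y^r z^n,$$ where $uAd$ denotes the Dyck path obtained by an up-step, followed by $A$, followed by a down-step. Let $P(x,q,t,v,y)=H_1(x,q,t,v/y)\,H_2(x,q,ty,v)$, expanded as $P=\sum_{n\ge0}\sum_{j\ge -n}P_{j,n}(x,q,y)v^jt^n$, and let $\mathrm{diag}^z_{v,t}P=\sum_{n\ge0}P_{n,n}(x,q,y)z^n$. Then $$\mathrm{diag}^z_{v,t}\ H_1(x,q,t,v/y)\,H_2(x,q,ty,v)=H_3(x,q,z,y).$$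
   Context: A Dyck path of semilength $n$ is a lattice path from $(0,0)$ to $(2n,0)$ with up-steps $u=(1,1)$ and down-steps $d=(1,-1)$ never going below the $x$-axis; $\mathcal{D}_n$ is the set of such paths (identified with words in $u,d$). A tunnel of $D$ is a horizontal segment between two lattice points of $D$ meeting $D$ only at these two points and lying below $D$; tunnels correspond bijectively to factorizations of the word $D=AuBdC$ with $B$ a Dyck path (the tunnel going from the start of this $u$ to the end of this $d$), so the midpoint of the tunnel has $x$-coordinate $\ell(A)+\ell(B)/2+1$ where $\ell$ denotes word length. For $D\in\mathcal{D}_n$ and $r\in\mathbb{Z}$, $\mathrm{ct}_r(D)$ is the number of tunnels of $D$ whose midpoint has $x$-coordinate equal to $n-r$, and $\mathrm{lt}_r(D)$ is the number of tunnels whose midpoint has $x$-coordinate strictly less than $n-r$. -}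

module Defs where

open import Data.Bool using (Bool; true; false; _∧_; if_then_else_)
open import Data.Nat using (ℕ; zero; suc; _+_; _*_; _∸_; _≡ᵇ_)
open import Data.Integer as ℤ using (ℤ; +_; -_; ∣_∣)
open import Data.List using (List; []; _∷_; _++_; length; map; concatMap; filterᵇ; upTo)
open import Data.Nat.ListAction using (sum)
open import Data.Product using (_×_; _,_)
open import Relation.Nullary.Decidable using (⌊_⌋)

data Step : Set where
  u d : Step

Word : Set
Word = List Step

dyckFrom : ℕ → Word → Bool
dyckFrom zero    []      = true
dyckFrom (suc _) []      = false
dyckFrom h       (u ∷ w) = dyckFrom (suc h) w
dyckFrom zero    (d ∷ w) = false
dyckFrom (suc h) (d ∷ w) = dyckFrom h w

isDyck : Word → Bool
isDyck = dyckFrom 0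

words : ℕ → List Word
words zero    = [] ∷ []
words (suc m) = map (u ∷_) (words m) ++ map (d ∷_) (words m)

-- 𝒟_n : the Dyck paths of semilength n (each exactly once)
dyckPaths : ℕ → List Word
dyckPaths n = filterᵇ isDyck (words (2 * n))

-- Tunnels: factorizations D = A u B d C with B a Dyck path.
-- A tunnel is recorded by the pair (ℓ(A), ℓ(B)).

splits : Word → List (Word × Word)
splits []      = ([] , []) ∷ []
splits (s ∷ w) = ([] , s ∷ w) ∷ map (consFst s) (splits w)
  where
    consFst : Step → Word × Word → Word × Word
    consFst x (p , q) = (x ∷ p , q)

startsWithD : Word → Bool
startsWithD (d ∷ _) = true
startsWithD _       = false

tunnels : Word → List (ℕ × ℕ)
tunnels D = concatMap outer (splits D)
  where
    -- R = B ++ C' with C' = d ∷ C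
    inner : ℕ → Word × Word → List (ℕ × ℕ)
    inner ℓA (B , C') = if isDyck B ∧ startsWithD C' then (ℓA , length B) ∷ [] else []
    -- D = A ++ (u ∷ R)
    outer : Word × Word → List (ℕ × ℕ)
    outer (A , u ∷ R) = concatMap (inner (length A)) (splits R)
    outer (A , _)     = []

-- twice the x-coordinate of the midpoint: 2 (ℓ(A) + ℓ(B)/2 + 1)
mid2 : ℕ × ℕ → ℤ
mid2 (ℓA , ℓB) = + (2 * ℓA + ℓB + 2)

-- ct_r(D), lt_r(D) for D ∈ 𝒟_n (n passed explicitly):
-- midpoint = n - r   ⇔  2·midpoint = 2(n - r)
ct : ℕ → ℤ → Word → ℕ
ct n r D = length (filterᵇ (λ τ → ⌊ mid2 τ ℤ.≟ (+ 2) ℤ.* (+ n ℤ.- r) ⌋) (tunnels D))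

lt : ℕ → ℤ → Word → ℕ
lt n r D = length (filterᵇ (λ τ → ⌊ mid2 τ ℤ.<? (+ 2) ℤ.* (+ n ℤ.- r) ⌋) (tunnels D))

count : (Word → Bool) → List Word → ℕ
count p ws = length (filterᵇ p ws)

-- [x^a q^b v^k t^n] H₁(x,q,t,v)
H₁ : ℕ → ℕ → ℤ → ℕ → ℕ
H₁ a b k zero    = 0
H₁ a b k (suc m) =
  if ⌊ (- (+ suc m)) ℤ.≤? k ⌋
  then count (λ A → (ct (suc m) (- k) (u ∷ A ++ d ∷ []) ≡ᵇ a)
                  ∧ (lt (suc m) (- k) (u ∷ A ++ d ∷ []) ≡ᵇ b))
             (dyckPaths m)
  else 0

-- [x^a q^b v^r t^n] H₂(x,q,t,v)
H₂ : ℕ → ℕ → ℤ → ℕ → ℕ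
H₂ a b r n =
  if ⌊ (- (+ n)) ℤ.≤? r ⌋
  then count (λ B → (ct n r B ≡ᵇ a) ∧ (lt n r B ≡ᵇ b)) (dyckPaths n)
  else 0

-- [x^a q^b y^r z^n] H₃(x,q,z,y)
H₃ : ℕ → ℕ → ℤ → ℕ → ℕ
H₃ a b r zero    = 0
H₃ a b r (suc m) =
  if ⌊ (- (+ suc m)) ℤ.≤? r ⌋ ∧ ⌊ r ℤ.≤? + suc m ⌋
  then count (λ D → (ct (suc m) r D ≡ᵇ a) ∧ (lt (suc m) r D ≡ᵇ b)) (dyckPaths (suc m))
  else 0

Σℕ : ℕ → (ℕ → ℕ) → ℕ
Σℕ n f = sum (map f (upTo (suc n)))

-- Σ_{lo ≤ k ≤ hi} f k  (empty if hi < lo)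
Σℤ : ℤ → ℤ → (ℤ → ℕ) → ℕ
Σℤ lo hi f =
  if ⌊ lo ℤ.≤? hi ⌋
  then sum (map (λ i → f (lo ℤ.+ + i)) (upTo (suc ∣ hi ℤ.- lo ∣)))
  else 0

[_≟ℤ_] : ℤ → ℤ → ℕ
[ m ≟ℤ m' ] = if ⌊ m ℤ.≟ m' ⌋ then 1 else 0

-- A term x^{a₁} q^{b₁} v^k t^{n₁} of H₁ becomes x^{a₁} q^{b₁} v^k y^{-k} t^{n₁};
-- a term x^{a₂} q^{b₂} v^r t^{n₂} of H₂ becomes x^{a₂} q^{b₂} v^r y^{n₂} t^{n₂}.
-- [x^a q^b y^m v^j t^n] P is the (finite) Cauchy-product sum below; the
-- k-range [-n₁, j+n₂] is exactly where both H₁ (k ≥ -n₁) and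
-- H₂ (r = j-k ≥ -n₂) can be nonzero.
Pcoeff : ℕ → ℕ → ℤ → ℕ → ℤ → ℕ
Pcoeff a b j n m =
  Σℕ n λ n₁ → Σℕ a λ a₁ → Σℕ b λ b₁ →
    Σℤ (- (+ n₁)) (j ℤ.+ + (n ∸ n₁)) λ k →
      H₁ a₁ b₁ k n₁ * H₂ (a ∸ a₁) (b ∸ b₁) (j ℤ.- k) (n ∸ n₁)
        * [ m ≟ℤ (+ (n ∸ n₁) ℤ.- k) ]

-- [x^a q^b y^m z^n] diag^z_{v,t} P = [x^a q^b y^m] P_{n,n}
diagP : ℕ → ℕ → ℕ → ℤ → ℕ
diagP a b n m = Pcoeff a b (+ n) n m

{-# OPTIONS --safe #-}
-- A path D ∈ 𝒟ₙ factors uniquely by its first return as D = (uAd)B with A ∈ 𝒟ⱼ, B ∈ 𝒟_q and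
-- n = j + 1 + q, and the tunnels of D are those of uAd together with those of B moved 2(j + 1)
-- steps to the right. Comparing midpoints with n − m in D is therefore the same as comparing them
-- with (j + 1) − (m − q) in uAd and with q − (m + j + 1) in B, so ct and lt of D are the sums of
-- those of the two parts. In the coefficient of zⁿ of the diagonal, the factor [m = q − k] selects
-- exactly these parameters (k = q − m) for an H₁-term of size j + 1 and an H₂-term of size q, and
-- this k lies in the summation range iff −n ≤ m ≤ n. The convolution over a₁ + a₂ = a and
-- b₁ + b₂ = b then reassembles the count over 𝒟ₙ that defines H₃.
module Submission where

open import Defs
open import Data.Bool using (Bool; true; false; _∧_; if_then_else_)
open import Data.Bool.Properties using (if-eta; if-float)
open import Data.List using (List; []; _∷_; _++_; length; map; concatMap; filterᵇ; applyUpTo; upTo)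
open import Data.List.Properties using (map-cong; map-++; map-∘; map-id; ++-assoc; concatMap-cong; concatMap-map; map-concatMap; length-++; filter-++)
open import Data.Nat.ListAction.Properties using (sum-++)
open import Data.Nat as ℕ using (ℕ; zero; suc; _+_; _*_; _∸_; _≤_; _<_; z≤n; s≤s; _≡ᵇ_)
import Data.Nat.Properties as ℕ
open import Algebra.Properties.CommutativeSemigroup ℕ.+-commutativeSemigroup using () renaming (interchange to +-interchange)
open import Algebra.Properties.CommutativeSemigroup ℕ.*-commutativeSemigroup using () renaming (interchange to *-interchange)
open import Data.Nat.ListAction using (sum)
open import Data.Integer as ℤ using (ℤ; +_; -_; ∣_∣)
import Data.Integer.Properties as ℤ
open import Data.Integer.Tactic.RingSolver using (solve-∀)
import Data.Nat.Tactic.RingSolver as ℕ-Solver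
open import Function using (_∘_; id; _⇔_; mk⇔; Equivalence)
open import Relation.Nullary using (Dec; yes; no; ¬_; contradiction)
open import Data.Product using (_×_; _,_; proj₁; proj₂; map₁; map₂)
open import Relation.Nullary.Decidable using (_×-dec_; T?; dec-true; dec-false; ⌊_⌋; isYes≗does; does-⇔)
open import Relation.Binary.PropositionalEquality
open ≡-Reasoning

-- Finite sums

∑ : ℕ → (ℕ → ℕ) → ℕ
∑ zero    f = 0
∑ (suc n) f = f 0 + ∑ n (f ∘ suc)

sum-map-applyUpTo : ∀ (f g : ℕ → ℕ) n → sum (map f (applyUpTo g n)) ≡ ∑ n (f ∘ g)
sum-map-applyUpTo f g zero    = refl
sum-map-applyUpTo f g (suc n) = cong (_+_ (f (g 0))) (sum-map-applyUpTo f (g ∘ suc) n)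

Σℕ≡∑ : ∀ n f → Σℕ n f ≡ ∑ (suc n) f
Σℕ≡∑ n f = sum-map-applyUpTo f id (suc n)

sum-map-zero : ∀ {A : Set} (xs : List A) → sum (map (λ _ → 0) xs) ≡ 0
sum-map-zero []       = refl
sum-map-zero (_ ∷ xs) = sum-map-zero xs

Σℕ-cong : ∀ n {f g : ℕ → ℕ} → (∀ i → f i ≡ g i) → Σℕ n f ≡ Σℕ n g
Σℕ-cong n e = cong sum (map-cong e (upTo (suc n)))

Σℕ-zero : ∀ n {f : ℕ → ℕ} → (∀ i → f i ≡ 0) → Σℕ n f ≡ 0
Σℕ-zero n e = trans (Σℕ-cong n e) (sum-map-zero (upTo (suc n)))

∑-cong : ∀ n {f g : ℕ → ℕ} → (∀ i → i < n → f i ≡ g i) → ∑ n f ≡ ∑ n g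
∑-cong zero    e = refl
∑-cong (suc n) e = cong₂ _+_ (e 0 (s≤s z≤n)) (∑-cong n (λ i i<n → e (suc i) (s≤s i<n)))

∑-zero : ∀ n {f : ℕ → ℕ} → (∀ i → i < n → f i ≡ 0) → ∑ n f ≡ 0
∑-zero zero    e = refl
∑-zero (suc n) e = cong₂ _+_ (e 0 (s≤s z≤n)) (∑-zero n (λ i i<n → e (suc i) (s≤s i<n)))

∑-+ : ∀ n (f g : ℕ → ℕ) → ∑ n (λ i → f i + g i) ≡ ∑ n f + ∑ n g
∑-+ zero    f g = refl
∑-+ (suc n) f g = trans (cong (_+_ (f 0 + g 0)) (∑-+ n (f ∘ suc) (g ∘ suc))) (+-interchange (f 0) (g 0) _ _)

*-distribˡ-∑ : ∀ c n (f : ℕ → ℕ) → c * ∑ n f ≡ ∑ n (λ i → c * f i)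
*-distribˡ-∑ c zero    f = ℕ.*-zeroʳ c
*-distribˡ-∑ c (suc n) f = trans (ℕ.*-distribˡ-+ c (f 0) _) (cong (_+_ (c * f 0)) (*-distribˡ-∑ c n (f ∘ suc)))

∑-product : ∀ n m (f g : ℕ → ℕ) → ∑ n (λ i → ∑ m (λ j → f i * g j)) ≡ ∑ n f * ∑ m g
∑-product n m f g = begin
  ∑ n (λ i → ∑ m (λ j → f i * g j)) ≡⟨ ∑-cong n (λ i _ → *-distribˡ-∑ (f i) m g) ⟨
  ∑ n (λ i → f i * ∑ m g)            ≡⟨ ∑-cong n (λ i _ → ℕ.*-comm (f i) (∑ m g)) ⟩
  ∑ n (λ i → ∑ m g * f i)            ≡⟨ *-distribˡ-∑ (∑ m g) n f ⟨
  ∑ m g * ∑ n f                      ≡⟨ ℕ.*-comm (∑ m g) (∑ n f) ⟩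
  ∑ n f * ∑ m g                      ∎

∑-single : ∀ n {f : ℕ → ℕ} j → j < n → (∀ i → i ≢ j → f i ≡ 0) → ∑ n f ≡ f j
∑-single (suc n) zero    _         off =
  trans (cong (_+_ _) (∑-zero n (λ i _ → off (suc i) λ ()))) (ℕ.+-identityʳ _)
∑-single (suc n) (suc j) (s≤s j<n) off =
  cong₂ _+_ (off 0 λ ()) (∑-single n j j<n (λ i i≢j → off (suc i) (i≢j ∘ ℕ.suc-injective)))

∑-evens : ∀ N (F : ℕ → ℕ) → (∀ j → F (suc (2 * j)) ≡ 0) → ∑ (suc (2 * N)) F ≡ ∑ (suc N) (λ j → F (2 * j))
∑-evens zero    F odd = refl
∑-evens (suc N) F odd = begin
  ∑ (suc (2 * suc N)) F                              ≡⟨ cong (λ k → ∑ (suc k) F) (ℕ.*-suc 2 N) ⟩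
  F 0 + (F 1 + ∑ (suc (2 * N)) (F ∘ suc ∘ suc))      ≡⟨ cong (λ x → F 0 + (x + ∑ (suc (2 * N)) (F ∘ suc ∘ suc))) (odd 0) ⟩
  F 0 + ∑ (suc (2 * N)) (F ∘ suc ∘ suc)              ≡⟨ cong (_+_ (F 0)) (∑-evens N (F ∘ suc ∘ suc) odd′) ⟩
  F 0 + ∑ (suc N) (λ j → F (suc (suc (2 * j))))      ≡⟨ cong (_+_ (F 0)) (∑-cong (suc N) (λ j _ → cong F (ℕ.*-suc 2 j))) ⟨
  ∑ (suc (suc N)) (λ j → F (2 * j))                  ∎
  where
  odd′ : ∀ j → F (suc (suc (suc (2 * j)))) ≡ 0
  odd′ j = trans (cong (F ∘ suc) (sym (ℕ.*-suc 2 j))) (odd (suc j))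


⌊⌋-true : ∀ {P : Set} (p? : Dec P) → P → ⌊ p? ⌋ ≡ true
⌊⌋-true p? p = trans (isYes≗does p?) (dec-true p? p)

⌊⌋-false : ∀ {P : Set} (p? : Dec P) → ¬ P → ⌊ p? ⌋ ≡ false
⌊⌋-false p? ¬p = trans (isYes≗does p?) (dec-false p? ¬p)

⌊⌋-⇔ : ∀ {P Q : Set} → P ⇔ Q → (p? : Dec P) (q? : Dec Q) → ⌊ p? ⌋ ≡ ⌊ q? ⌋
⌊⌋-⇔ P⇔Q p? q? = trans (isYes≗does p?) (trans (does-⇔ P⇔Q p? q?) (sym (isYes≗does q?)))

𝟙 : Bool → ℕ
𝟙 b = if b then 1 else 0

𝟙-∧ : ∀ x y → 𝟙 (x ∧ y) ≡ 𝟙 x * 𝟙 y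
𝟙-∧ false y = refl
𝟙-∧ true  y = sym (ℕ.+-identityʳ (𝟙 y))

≡ᵇ-true : ∀ {m n} → m ≡ n → (m ≡ᵇ n) ≡ true
≡ᵇ-true {m} {n} m≡n = dec-true (T? (m ≡ᵇ n)) (ℕ.≡⇒≡ᵇ m n m≡n)

≡ᵇ-false : ∀ {m n} → m ≢ n → (m ≡ᵇ n) ≡ false
≡ᵇ-false {m} {n} m≢n = dec-false (T? (m ≡ᵇ n)) (m≢n ∘ ℕ.≡ᵇ⇒≡ m n)

≡ᵇ-⇔ : ∀ {m n m′ n′} → (m ≡ n) ⇔ (m′ ≡ n′) → (m ≡ᵇ n) ≡ (m′ ≡ᵇ n′)
≡ᵇ-⇔ {m} {n} m≡n⇔ with m ℕ.≟ n
... | yes m≡n = trans (≡ᵇ-true m≡n) (sym (≡ᵇ-true (Equivalence.to m≡n⇔ m≡n)))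
... | no  m≢n = trans (≡ᵇ-false m≢n) (sym (≡ᵇ-false (m≢n ∘ Equivalence.from m≡n⇔)))

∑-𝟙-convolution : ∀ a c₁ c₂ → ∑ (suc a) (λ a₁ → 𝟙 (c₁ ≡ᵇ a₁) * 𝟙 (c₂ ≡ᵇ a ∸ a₁)) ≡ 𝟙 (c₁ + c₂ ≡ᵇ a)
∑-𝟙-convolution a c₁ c₂ with c₁ ℕ.≤? a
... | yes c₁≤a = begin
  ∑ (suc a) (λ a₁ → 𝟙 (c₁ ≡ᵇ a₁) * 𝟙 (c₂ ≡ᵇ a ∸ a₁)) ≡⟨ ∑-single (suc a) c₁ (s≤s c₁≤a) off ⟩
  𝟙 (c₁ ≡ᵇ c₁) * 𝟙 (c₂ ≡ᵇ a ∸ c₁)                     ≡⟨ cong (λ b → 𝟙 b * 𝟙 (c₂ ≡ᵇ a ∸ c₁)) (≡ᵇ-true {c₁} refl) ⟩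
  𝟙 (c₂ ≡ᵇ a ∸ c₁) + 0                                ≡⟨ ℕ.+-identityʳ _ ⟩
  𝟙 (c₂ ≡ᵇ a ∸ c₁)                                    ≡⟨ cong 𝟙 (≡ᵇ-⇔ {c₂} (mk⇔ to from)) ⟩
  𝟙 (c₁ + c₂ ≡ᵇ a)                                    ∎
  where
  off : ∀ i → i ≢ c₁ → 𝟙 (c₁ ≡ᵇ i) * 𝟙 (c₂ ≡ᵇ a ∸ i) ≡ 0
  off i i≢c₁ = cong (λ b → 𝟙 b * 𝟙 (c₂ ≡ᵇ a ∸ i)) (≡ᵇ-false {c₁} (i≢c₁ ∘ sym))
  to : c₂ ≡ a ∸ c₁ → c₁ + c₂ ≡ a
  to refl = ℕ.m+[n∸m]≡n c₁≤a
  from : c₁ + c₂ ≡ a → c₂ ≡ a ∸ c₁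
  from refl = sym (ℕ.m+n∸m≡n c₁ c₂)
... | no c₁≰a = begin
  ∑ (suc a) (λ a₁ → 𝟙 (c₁ ≡ᵇ a₁) * 𝟙 (c₂ ≡ᵇ a ∸ a₁)) ≡⟨ ∑-zero (suc a) off ⟩
  0                                                   ≡⟨ cong 𝟙 (≡ᵇ-false {c₁ + c₂} (λ { refl → c₁≰a (ℕ.m≤m+n c₁ c₂) })) ⟨
  𝟙 (c₁ + c₂ ≡ᵇ a)                                    ∎
  where
  off : ∀ i → i < suc a → 𝟙 (c₁ ≡ᵇ i) * 𝟙 (c₂ ≡ᵇ a ∸ i) ≡ 0
  off i i≤a = cong (λ b → 𝟙 b * 𝟙 (c₂ ≡ᵇ a ∸ i)) (≡ᵇ-false {c₁} (λ { refl → c₁≰a (ℕ.≤-pred i≤a) }))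

Σℕ-𝟙-convolution₂ : ∀ a b c₁ l₁ c₂ l₂ →
  Σℕ a (λ a₁ → Σℕ b (λ b₁ → 𝟙 ((c₁ ≡ᵇ a₁) ∧ (l₁ ≡ᵇ b₁)) * 𝟙 ((c₂ ≡ᵇ a ∸ a₁) ∧ (l₂ ≡ᵇ b ∸ b₁))))
  ≡ 𝟙 ((c₁ + c₂ ≡ᵇ a) ∧ (l₁ + l₂ ≡ᵇ b))
Σℕ-𝟙-convolution₂ a b c₁ l₁ c₂ l₂ = begin
  Σℕ a (λ a₁ → Σℕ b (φ a₁))
    ≡⟨ trans (Σℕ≡∑ a _) (∑-cong (suc a) λ a₁ _ → trans (Σℕ≡∑ b (φ a₁)) (∑-cong (suc b) λ b₁ _ → separate a₁ b₁)) ⟩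
  ∑ (suc a) (λ a₁ → ∑ (suc b) (λ b₁ → f a₁ * g b₁))
    ≡⟨ ∑-product (suc a) (suc b) f g ⟩
  ∑ (suc a) f * ∑ (suc b) g
    ≡⟨ cong₂ _*_ (∑-𝟙-convolution a c₁ c₂) (∑-𝟙-convolution b l₁ l₂) ⟩
  𝟙 (c₁ + c₂ ≡ᵇ a) * 𝟙 (l₁ + l₂ ≡ᵇ b)
    ≡⟨ 𝟙-∧ (c₁ + c₂ ≡ᵇ a) (l₁ + l₂ ≡ᵇ b) ⟨
  𝟙 ((c₁ + c₂ ≡ᵇ a) ∧ (l₁ + l₂ ≡ᵇ b)) ∎
  where
  φ : ℕ → ℕ → ℕ
  φ a₁ b₁ = 𝟙 ((c₁ ≡ᵇ a₁) ∧ (l₁ ≡ᵇ b₁)) * 𝟙 ((c₂ ≡ᵇ a ∸ a₁) ∧ (l₂ ≡ᵇ b ∸ b₁))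
  f g : ℕ → ℕ
  f a₁ = 𝟙 (c₁ ≡ᵇ a₁) * 𝟙 (c₂ ≡ᵇ a ∸ a₁)
  g b₁ = 𝟙 (l₁ ≡ᵇ b₁) * 𝟙 (l₂ ≡ᵇ b ∸ b₁)
  separate : ∀ a₁ b₁ → φ a₁ b₁ ≡ f a₁ * g b₁
  separate a₁ b₁ = trans (cong₂ _*_ (𝟙-∧ (c₁ ≡ᵇ a₁) _) (𝟙-∧ (c₂ ≡ᵇ a ∸ a₁) _)) (*-interchange (𝟙 (c₁ ≡ᵇ a₁)) (𝟙 (l₁ ≡ᵇ b₁)) (𝟙 (c₂ ≡ᵇ a ∸ a₁)) (𝟙 (l₂ ≡ᵇ b ∸ b₁)))

i+j-j≡i : ∀ i j → (i ℤ.+ j) ℤ.- j ≡ i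
i+j-j≡i = solve-∀

i-j+j≡i : ∀ i j → (i ℤ.- j) ℤ.+ j ≡ i
i-j+j≡i = solve-∀

i+j≡i+k⇒j≡k : ∀ i {j k} → i ℤ.+ j ≡ i ℤ.+ k → j ≡ k
i+j≡i+k⇒j≡k i {j} {k} e = trans (sym (cancel i j)) (trans (cong (ℤ._- i) e) (cancel i k))
  where
  cancel : ∀ i j → (i ℤ.+ j) ℤ.- i ≡ j
  cancel = solve-∀

lo+∣x-lo∣≡x : ∀ {lo x} → lo ℤ.≤ x → lo ℤ.+ + ∣ x ℤ.- lo ∣ ≡ x
lo+∣x-lo∣≡x {lo} {x} lo≤x = begin
  lo ℤ.+ + ∣ x ℤ.- lo ∣  ≡⟨ cong (ℤ._+_ lo) (ℤ.0≤i⇒+∣i∣≡i (ℤ.i≤j⇒0≤j-i lo≤x)) ⟩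
  lo ℤ.+ (x ℤ.- lo)      ≡⟨ cancel lo x ⟩
  x                      ∎
  where
  cancel : ∀ lo x → lo ℤ.+ (x ℤ.- lo) ≡ x
  cancel = solve-∀

≤-translate : ∀ c {i j i′ j′} → i ℤ.+ c ≡ i′ → j ℤ.+ c ≡ j′ → (i ℤ.≤ j) ⇔ (i′ ℤ.≤ j′)
≤-translate c {i} {j} refl refl =
  mk⇔ (ℤ.+-monoˡ-≤ c) (λ le → subst₂ ℤ._≤_ (i+j-j≡i i c) (i+j-j≡i j c) (ℤ.+-monoˡ-≤ (- c) le))

i≡k-j⇒j≡k-i : ∀ k {i j} → i ≡ k ℤ.- j → j ≡ k ℤ.- i
i≡k-j⇒j≡k-i k {j = j} refl = sym (k-[k-j]≡j k j)
  where
  k-[k-j]≡j : ∀ k j → k ℤ.- (k ℤ.- j) ≡ j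
  k-[k-j]≡j = solve-∀

[≟ℤ]-transpose : ∀ m c k → [ m ≟ℤ c ℤ.- k ] ≡ [ k ≟ℤ c ℤ.- m ]
[≟ℤ]-transpose m c k = cong 𝟙 (⌊⌋-⇔ (mk⇔ (i≡k-j⇒j≡k-i c) (i≡k-j⇒j≡k-i c)) (m ℤ.≟ c ℤ.- k) (k ℤ.≟ c ℤ.- m))

Σℤ-cong : ∀ lo hi {f g : ℤ → ℕ} → (∀ k → f k ≡ g k) → Σℤ lo hi f ≡ Σℤ lo hi g
Σℤ-cong lo hi e =
  cong (λ s → if ⌊ lo ℤ.≤? hi ⌋ then s else 0) (cong sum (map-cong (λ i → e (lo ℤ.+ + i)) (upTo (suc ∣ hi ℤ.- lo ∣))))

Σℤ-zero : ∀ lo hi → Σℤ lo hi (λ _ → 0) ≡ 0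
Σℤ-zero lo hi =
  trans (cong (λ s → if ⌊ lo ℤ.≤? hi ⌋ then s else 0) (sum-map-zero (upTo (suc ∣ hi ℤ.- lo ∣)))) (if-eta ⌊ lo ℤ.≤? hi ⌋)

Σℤ-unfold : ∀ {lo hi} (f : ℤ → ℕ) → lo ℤ.≤ hi → Σℤ lo hi f ≡ ∑ (suc ∣ hi ℤ.- lo ∣) (λ i → f (lo ℤ.+ + i))
Σℤ-unfold {lo} {hi} f lo≤hi =
  trans (cong (λ b → if b then sum (map f′ (upTo n)) else 0) (⌊⌋-true (lo ℤ.≤? hi) lo≤hi)) (sum-map-applyUpTo f′ id n)
  where
  n : ℕ
  n = suc ∣ hi ℤ.- lo ∣
  f′ : ℕ → ℕ
  f′ i = f (lo ℤ.+ + i)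

Σℤ-δ : ∀ {lo hi c} (F : ℤ → ℕ) → lo ℤ.≤ c → c ℤ.≤ hi → Σℤ lo hi (λ k → F k * [ k ≟ℤ c ]) ≡ F c
Σℤ-δ {lo} {hi} {c} F lo≤c c≤hi = begin
  Σℤ lo hi G                                     ≡⟨ Σℤ-unfold G (ℤ.≤-trans lo≤c c≤hi) ⟩
  ∑ (suc ∣ hi ℤ.- lo ∣) (λ i → G (lo ℤ.+ + i))   ≡⟨ ∑-single _ i₀ (s≤s i₀≤) off ⟩
  G (lo ℤ.+ + i₀)                                ≡⟨ cong G (lo+∣x-lo∣≡x lo≤c) ⟩
  F c * 𝟙 ⌊ c ℤ.≟ c ⌋                             ≡⟨ cong (λ b → F c * 𝟙 b) (⌊⌋-true (c ℤ.≟ c) refl) ⟩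
  F c * 1                                        ≡⟨ ℕ.*-identityʳ (F c) ⟩
  F c                                            ∎
  where
  G : ℤ → ℕ
  G k = F k * [ k ≟ℤ c ]
  i₀ : ℕ
  i₀ = ∣ c ℤ.- lo ∣
  i₀≤ : i₀ ≤ ∣ hi ℤ.- lo ∣
  i₀≤ = ℤ.drop‿+≤+ (subst₂ ℤ._≤_
    (sym (ℤ.0≤i⇒+∣i∣≡i (ℤ.i≤j⇒0≤j-i lo≤c)))
    (sym (ℤ.0≤i⇒+∣i∣≡i (ℤ.i≤j⇒0≤j-i (ℤ.≤-trans lo≤c c≤hi))))
    (ℤ.+-monoˡ-≤ (- lo) c≤hi))
  off : ∀ i → i ≢ i₀ → G (lo ℤ.+ + i) ≡ 0
  off i i≢i₀ = trans (cong (λ b → F (lo ℤ.+ + i) * 𝟙 b) (⌊⌋-false (lo ℤ.+ + i ℤ.≟ c)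
    (λ e → i≢i₀ (ℤ.+-injective (i+j≡i+k⇒j≡k lo (trans e (sym (lo+∣x-lo∣≡x lo≤c))))))))
    (ℕ.*-zeroʳ (F (lo ℤ.+ + i)))

Σℤ-δ-out : ∀ {lo hi c} (F : ℤ → ℕ) → ¬ (lo ℤ.≤ c × c ℤ.≤ hi) → Σℤ lo hi (λ k → F k * [ k ≟ℤ c ]) ≡ 0
Σℤ-δ-out {lo} {hi} {c} F c∉ with lo ℤ.≤? hi
... | no  _     = refl
... | yes lo≤hi = trans (sum-map-applyUpTo (λ i → F (lo ℤ.+ + i) * [ lo ℤ.+ + i ≟ℤ c ]) id (suc ∣ hi ℤ.- lo ∣)) (∑-zero _ off)
  where
  off : ∀ i → i < suc ∣ hi ℤ.- lo ∣ → F (lo ℤ.+ + i) * [ lo ℤ.+ + i ≟ℤ c ] ≡ 0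
  off i i< = trans (cong (λ b → F (lo ℤ.+ + i) * 𝟙 b) (⌊⌋-false (lo ℤ.+ + i ℤ.≟ c) λ { refl →
    c∉ (ℤ.i≤i+j lo (+ i) , subst (ℤ._≤_ _) (lo+∣x-lo∣≡x lo≤hi) (ℤ.+-monoʳ-≤ lo (ℤ.+≤+ (ℕ.≤-pred i<)))) }))
    (ℕ.*-zeroʳ (F (lo ℤ.+ + i)))

-- Sums over Dyck paths

ΣPath : ℕ → ℕ → (Word → ℕ) → ℕ
ΣPath zero    zero    f = f []
ΣPath (suc h) zero    f = 0
ΣPath zero    (suc m) f = ΣPath 1 m (f ∘ (u ∷_))
ΣPath (suc h) (suc m) f = ΣPath (suc (suc h)) m (f ∘ (u ∷_)) + ΣPath h m (f ∘ (d ∷_))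

sum-map-words : ∀ (F : Word → ℕ) m →
  sum (map F (words (suc m))) ≡ sum (map (F ∘ (u ∷_)) (words m)) + sum (map (F ∘ (d ∷_)) (words m))
sum-map-words F m = begin
  sum (map F (map (u ∷_) (words m) ++ map (d ∷_) (words m)))
    ≡⟨ cong sum (map-++ F (map (u ∷_) (words m)) _) ⟩
  sum (map F (map (u ∷_) (words m)) ++ map F (map (d ∷_) (words m)))
    ≡⟨ sum-++ (map F (map (u ∷_) (words m))) _ ⟩
  sum (map F (map (u ∷_) (words m))) + sum (map F (map (d ∷_) (words m)))
    ≡⟨ cong₂ _+_ (cong sum (map-∘ (words m))) (cong sum (map-∘ (words m))) ⟨
  sum (map (F ∘ (u ∷_)) (words m)) + sum (map (F ∘ (d ∷_)) (words m)) ∎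

sum-words≡ΣPath : ∀ h m (f : Word → ℕ) → sum (map (λ w → if dyckFrom h w then f w else 0) (words m)) ≡ ΣPath h m f
sum-words≡ΣPath zero    zero    f = ℕ.+-identityʳ (f [])
sum-words≡ΣPath (suc h) zero    f = refl
sum-words≡ΣPath zero    (suc m) f = begin
  sum (map (λ w → if dyckFrom 0 w then f w else 0) (words (suc m)))  ≡⟨ sum-map-words _ m ⟩
  _ + sum (map (λ _ → 0) (words m))  ≡⟨ cong₂ _+_ (sum-words≡ΣPath 1 m (f ∘ (u ∷_))) (sum-map-zero (words m)) ⟩
  ΣPath 1 m (f ∘ (u ∷_)) + 0         ≡⟨ ℕ.+-identityʳ _ ⟩
  ΣPath 0 (suc m) f                  ∎
sum-words≡ΣPath (suc h) (suc m) f = trans (sum-map-words _ m)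
  (cong₂ _+_ (sum-words≡ΣPath (suc (suc h)) m (f ∘ (u ∷_))) (sum-words≡ΣPath h m (f ∘ (d ∷_))))

count-filterᵇ : ∀ (p q : Word → Bool) ws → count p (filterᵇ q ws) ≡ sum (map (λ w → if q w then 𝟙 (p w) else 0) ws)
count-filterᵇ p q []       = refl
count-filterᵇ p q (w ∷ ws) with q w
... | false = count-filterᵇ p q ws
... | true with p w
...   | true  = cong suc (count-filterᵇ p q ws)
...   | false = count-filterᵇ p q ws

count-dyckPaths : ∀ (p : Word → Bool) n → count p (dyckPaths n) ≡ ΣPath 0 (2 * n) (𝟙 ∘ p)
count-dyckPaths p n = trans (count-filterᵇ p isDyck (words (2 * n))) (sum-words≡ΣPath 0 (2 * n) (𝟙 ∘ p))

ΣPath-cong : ∀ h m {f g : Word → ℕ} → (∀ w → length w ≡ m → dyckFrom h w ≡ true → f w ≡ g w) → ΣPath h m f ≡ ΣPath h m g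
ΣPath-cong zero    zero    e = e [] refl refl
ΣPath-cong (suc h) zero    e = refl
ΣPath-cong zero    (suc m) e = ΣPath-cong 1 m (λ w ∣w∣ dw → e (u ∷ w) (cong suc ∣w∣) dw)
ΣPath-cong (suc h) (suc m) e = cong₂ _+_
  (ΣPath-cong (suc (suc h)) m (λ w ∣w∣ dw → e (u ∷ w) (cong suc ∣w∣) dw))
  (ΣPath-cong h m (λ w ∣w∣ dw → e (d ∷ w) (cong suc ∣w∣) dw))

ΣPath-cong′ : ∀ h m {f g : Word → ℕ} → (∀ w → f w ≡ g w) → ΣPath h m f ≡ ΣPath h m g
ΣPath-cong′ h m e = ΣPath-cong h m (λ w _ _ → e w)

ΣPath-zero : ∀ h m → ΣPath h m (λ _ → 0) ≡ 0
ΣPath-zero zero    zero    = refl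
ΣPath-zero (suc h) zero    = refl
ΣPath-zero zero    (suc m) = ΣPath-zero 1 m
ΣPath-zero (suc h) (suc m) = cong₂ _+_ (ΣPath-zero (suc (suc h)) m) (ΣPath-zero h m)

ΣPath-+ : ∀ h m (f g : Word → ℕ) → ΣPath h m (λ w → f w + g w) ≡ ΣPath h m f + ΣPath h m g
ΣPath-+ zero    zero    f g = refl
ΣPath-+ (suc h) zero    f g = refl
ΣPath-+ zero    (suc m) f g = ΣPath-+ 1 m (f ∘ (u ∷_)) (g ∘ (u ∷_))
ΣPath-+ (suc h) (suc m) f g = trans
  (cong₂ _+_ (ΣPath-+ (suc (suc h)) m (f ∘ (u ∷_)) (g ∘ (u ∷_))) (ΣPath-+ h m (f ∘ (d ∷_)) (g ∘ (d ∷_))))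
  (+-interchange (ΣPath (suc (suc h)) m (f ∘ (u ∷_))) (ΣPath (suc (suc h)) m (g ∘ (u ∷_))) _ _)

*-distribˡ-ΣPath : ∀ c h m (f : Word → ℕ) → c * ΣPath h m f ≡ ΣPath h m (λ w → c * f w)
*-distribˡ-ΣPath c zero    zero    f = refl
*-distribˡ-ΣPath c (suc h) zero    f = ℕ.*-zeroʳ c
*-distribˡ-ΣPath c zero    (suc m) f = *-distribˡ-ΣPath c 1 m (f ∘ (u ∷_))
*-distribˡ-ΣPath c (suc h) (suc m) f = trans (ℕ.*-distribˡ-+ c _ _)
  (cong₂ _+_ (*-distribˡ-ΣPath c (suc (suc h)) m (f ∘ (u ∷_))) (*-distribˡ-ΣPath c h m (f ∘ (d ∷_))))

ΣPath-∑ : ∀ h m n (F : ℕ → Word → ℕ) → ΣPath h m (λ w → ∑ n (λ i → F i w)) ≡ ∑ n (λ i → ΣPath h m (F i))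
ΣPath-∑ h m zero    F = ΣPath-zero h m
ΣPath-∑ h m (suc n) F = trans (ΣPath-+ h m (F 0) _) (cong (_+_ (ΣPath h m (F 0))) (ΣPath-∑ h m n (F ∘ suc)))

Σℕ-ΣPath : ∀ n h m (F : ℕ → Word → ℕ) → Σℕ n (λ i → ΣPath h m (F i)) ≡ ΣPath h m (λ w → Σℕ n (λ i → F i w))
Σℕ-ΣPath n h m F = begin
  Σℕ n (λ i → ΣPath h m (F i))            ≡⟨ Σℕ≡∑ n _ ⟩
  ∑ (suc n) (λ i → ΣPath h m (F i))       ≡⟨ ΣPath-∑ h m (suc n) F ⟨
  ΣPath h m (λ w → ∑ (suc n) (λ i → F i w)) ≡⟨ ΣPath-cong′ h m (λ w → Σℕ≡∑ n (λ i → F i w)) ⟨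
  ΣPath h m (λ w → Σℕ n (λ i → F i w))    ∎

ΣPath-* : ∀ h m h′ m′ (f g : Word → ℕ) → ΣPath h m f * ΣPath h′ m′ g ≡ ΣPath h m (λ A → ΣPath h′ m′ (λ B → f A * g B))
ΣPath-* h m h′ m′ f g = begin
  ΣPath h m f * ΣPath h′ m′ g                        ≡⟨ ℕ.*-comm (ΣPath h m f) _ ⟩
  ΣPath h′ m′ g * ΣPath h m f                        ≡⟨ *-distribˡ-ΣPath (ΣPath h′ m′ g) h m f ⟩
  ΣPath h m (λ A → ΣPath h′ m′ g * f A)              ≡⟨ ΣPath-cong′ h m (λ A → ℕ.*-comm _ (f A)) ⟩
  ΣPath h m (λ A → f A * ΣPath h′ m′ g)              ≡⟨ ΣPath-cong′ h m (λ A → *-distribˡ-ΣPath (f A) h′ m′ g) ⟩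
  ΣPath h m (λ A → ΣPath h′ m′ (λ B → f A * g B))    ∎

ΣPath-odd : ∀ h m k (f : Word → ℕ) → h + m ≡ suc (2 * k) → ΣPath h m f ≡ 0
ΣPath-odd zero    zero    k       f ()
ΣPath-odd (suc h) zero    k       f _ = refl
ΣPath-odd zero    (suc m) k       f odd = ΣPath-odd 1 m k (f ∘ (u ∷_)) odd
ΣPath-odd (suc h) (suc m) zero    f odd = contradiction (trans (sym (ℕ.+-suc h m)) (ℕ.suc-injective odd)) ℕ.1+n≢0
ΣPath-odd (suc h) (suc m) (suc k) f odd = cong₂ _+_
  (ΣPath-odd (suc (suc h)) m (suc k) (f ∘ (u ∷_)) (trans (cong suc (sym (ℕ.+-suc h m))) odd))
  (ΣPath-odd h m k (f ∘ (d ∷_)) (ℕ.suc-injective (trans (sym (ℕ.+-suc h m)) (trans (ℕ.suc-injective odd) (ℕ.*-suc 2 k)))))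

ΣPath-firstPassage : ∀ c h m (f : Word → ℕ) →
  ΣPath (c + suc h) m f ≡ ∑ m (λ i → ΣPath c i (λ A → ΣPath h (m ∸ suc i) (λ B → f (A ++ d ∷ B))))
ΣPath-firstPassage zero    h zero    f = refl
ΣPath-firstPassage (suc c) h zero    f = refl
ΣPath-firstPassage zero    h (suc m) f = trans (ℕ.+-comm (ΣPath (suc (suc h)) m (f ∘ (u ∷_))) _)
  (cong (_+_ (ΣPath h m (f ∘ (d ∷_)))) (ΣPath-firstPassage 1 h m (f ∘ (u ∷_))))
ΣPath-firstPassage (suc c) h (suc m) f = trans
  (cong₂ _+_ (ΣPath-firstPassage (suc (suc c)) h m (f ∘ (u ∷_))) (ΣPath-firstPassage c h m (f ∘ (d ∷_))))
  (sym (∑-+ m _ _))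

ΣPath-firstReturn : ∀ N (f : Word → ℕ) →
  ΣPath 0 (2 * suc N) f ≡ ∑ (suc N) (λ j → ΣPath 0 (2 * j) (λ A → ΣPath 0 (2 * (N ∸ j)) (λ B → f (u ∷ A ++ d ∷ B))))
ΣPath-firstReturn N f = begin
  ΣPath 0 (2 * suc N) f
    ≡⟨ cong (λ m → ΣPath 0 m f) (ℕ.*-suc 2 N) ⟩
  ΣPath 1 (suc (2 * N)) (f ∘ (u ∷_))
    ≡⟨ ΣPath-firstPassage 0 0 (suc (2 * N)) (f ∘ (u ∷_)) ⟩
  ∑ (suc (2 * N)) (λ i → ΣPath 0 i (λ A → ΣPath 0 (2 * N ∸ i) (λ B → f (u ∷ A ++ d ∷ B))))
    ≡⟨ ∑-evens N F (λ j → ΣPath-odd 0 (suc (2 * j)) j (λ A → ΣPath 0 (2 * N ∸ suc (2 * j)) (λ B → f (u ∷ A ++ d ∷ B))) refl) ⟩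
  ∑ (suc N) (λ j → ΣPath 0 (2 * j) (λ A → ΣPath 0 (2 * N ∸ 2 * j) (λ B → f (u ∷ A ++ d ∷ B))))
    ≡⟨ ∑-cong (suc N) (λ j _ → cong (λ m → ΣPath 0 (2 * j) (λ A → ΣPath 0 m (λ B → f (u ∷ A ++ d ∷ B))))
                                    (ℕ.*-distribˡ-∸ 2 N j)) ⟨
  ∑ (suc N) (λ j → ΣPath 0 (2 * j) (λ A → ΣPath 0 (2 * (N ∸ j)) (λ B → f (u ∷ A ++ d ∷ B)))) ∎
  where
  F : ℕ → ℕ
  F i = ΣPath 0 i (λ A → ΣPath 0 (2 * N ∸ i) (λ B → f (u ∷ A ++ d ∷ B)))

ΣPath-convolution : ∀ a b h m h′ m′ (c₁ l₁ c₂ l₂ : Word → ℕ) →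
  Σℕ a (λ a₁ → Σℕ b (λ b₁ →
      ΣPath h m (λ A → 𝟙 ((c₁ A ≡ᵇ a₁) ∧ (l₁ A ≡ᵇ b₁)))
    * ΣPath h′ m′ (λ B → 𝟙 ((c₂ B ≡ᵇ a ∸ a₁) ∧ (l₂ B ≡ᵇ b ∸ b₁)))))
  ≡ ΣPath h m (λ A → ΣPath h′ m′ (λ B → 𝟙 ((c₁ A + c₂ B ≡ᵇ a) ∧ (l₁ A + l₂ B ≡ᵇ b))))
ΣPath-convolution a b h m h′ m′ c₁ l₁ c₂ l₂ = begin
  Σℕ a (λ a₁ → Σℕ b (λ b₁ → ΣPath h m (P₁ a₁ b₁) * ΣPath h′ m′ (P₂ a₁ b₁)))
    ≡⟨ Σℕ-cong a (λ a₁ → Σℕ-cong b (λ b₁ → ΣPath-* h m h′ m′ (P₁ a₁ b₁) (P₂ a₁ b₁))) ⟩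
  Σℕ a (λ a₁ → Σℕ b (λ b₁ → ΣPath h m (λ A → ΣPath h′ m′ (λ B → P₁ a₁ b₁ A * P₂ a₁ b₁ B))))
    ≡⟨ Σℕ-cong a (λ a₁ → Σℕ-ΣPath² b (λ b₁ A B → P₁ a₁ b₁ A * P₂ a₁ b₁ B)) ⟩
  Σℕ a (λ a₁ → ΣPath h m (λ A → ΣPath h′ m′ (λ B → Σℕ b (λ b₁ → P₁ a₁ b₁ A * P₂ a₁ b₁ B))))
    ≡⟨ Σℕ-ΣPath² a (λ a₁ A B → Σℕ b (λ b₁ → P₁ a₁ b₁ A * P₂ a₁ b₁ B)) ⟩
  ΣPath h m (λ A → ΣPath h′ m′ (λ B → Σℕ a (λ a₁ → Σℕ b (λ b₁ → P₁ a₁ b₁ A * P₂ a₁ b₁ B))))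
    ≡⟨ ΣPath-cong′ h m (λ A → ΣPath-cong′ h′ m′ (λ B → Σℕ-𝟙-convolution₂ a b (c₁ A) (l₁ A) (c₂ B) (l₂ B))) ⟩
  ΣPath h m (λ A → ΣPath h′ m′ (λ B → 𝟙 ((c₁ A + c₂ B ≡ᵇ a) ∧ (l₁ A + l₂ B ≡ᵇ b)))) ∎
  where
  P₁ P₂ : ℕ → ℕ → Word → ℕ
  P₁ a₁ b₁ A = 𝟙 ((c₁ A ≡ᵇ a₁) ∧ (l₁ A ≡ᵇ b₁))
  P₂ a₁ b₁ B = 𝟙 ((c₂ B ≡ᵇ a ∸ a₁) ∧ (l₂ B ≡ᵇ b ∸ b₁))
  Σℕ-ΣPath² : ∀ n (F : ℕ → Word → Word → ℕ) →
    Σℕ n (λ i → ΣPath h m (λ A → ΣPath h′ m′ (F i A))) ≡ ΣPath h m (λ A → ΣPath h′ m′ (λ B → Σℕ n (λ i → F i A B)))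
  Σℕ-ΣPath² n F = trans (Σℕ-ΣPath n h m _) (ΣPath-cong′ h m (λ A → Σℕ-ΣPath n h′ m′ (λ i → F i A)))

-- Tunnels of a concatenation

dyckFrom-u∷ : ∀ h w → dyckFrom h (u ∷ w) ≡ dyckFrom (suc h) w
dyckFrom-u∷ zero    w = refl
dyckFrom-u∷ (suc h) w = refl

dyckFrom-++ : ∀ h c A X → dyckFrom h A ≡ true → dyckFrom c X ≡ true → dyckFrom (h + c) (A ++ X) ≡ true
dyckFrom-++ zero    c []      X _  dX = dX
dyckFrom-++ (suc h) c []      X () dX
dyckFrom-++ h       c (u ∷ A) X dA dX =
  trans (dyckFrom-u∷ (h + c) (A ++ X)) (dyckFrom-++ (suc h) c A X (trans (sym (dyckFrom-u∷ h A)) dA) dX)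
dyckFrom-++ zero    c (d ∷ A) X () dX
dyckFrom-++ (suc h) c (d ∷ A) X dA dX = dyckFrom-++ h c A X dA dX

-- The length of the shortest prefix B of w with dyckFrom h B that is followed by a down-step, if any.
exits : ℕ → Word → List ℕ
exits h       []      = []
exits h       (u ∷ w) = map suc (exits (suc h) w)
exits zero    (d ∷ w) = 0 ∷ []
exits (suc h) (d ∷ w) = map suc (exits h w)

exits-++ : ∀ {k h} W X → k < h → dyckFrom h W ≡ true → exits k (W ++ X) ≡ exits k W
exits-++         []      X (s≤s _)   ()
exits-++         (u ∷ W) X (s≤s k≤h) dW = cong (map suc) (exits-++ W X (s≤s (s≤s k≤h)) dW)
exits-++ {zero}  (d ∷ W) X _         _  = refl
exits-++ {suc k} (d ∷ W) X (s≤s k<h) dW = cong (map suc) (exits-++ W X k<h dW)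

-- `tunnels` is built from where-bound helpers that cannot be named; `matching 0` and `tunnelsAt`
-- restate them, and `matching h` generalises the inner one to start height h.
matching : ℕ → ℕ → Word × Word → List (ℕ × ℕ)
matching h ℓ (B , C) = if dyckFrom h B ∧ startsWithD C then (ℓ , length B) ∷ [] else []

matching-∷ : ∀ h h′ ℓ s R → (∀ B → dyckFrom h (s ∷ B) ≡ dyckFrom h′ B) →
  concatMap (matching h′ ℓ) (splits R) ≡ map (ℓ ,_) (exits h′ R) →
  concatMap (matching h ℓ) (map (λ p → s ∷ proj₁ p , proj₂ p) (splits R)) ≡ map (ℓ ,_) (map suc (exits h′ R))
matching-∷ h h′ ℓ s R step ih = begin
  concatMap (matching h ℓ) (map (λ p → s ∷ proj₁ p , proj₂ p) (splits R))
    ≡⟨ concatMap-map (matching h ℓ) _ (splits R) ⟩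
  concatMap (λ p → matching h ℓ (s ∷ proj₁ p , proj₂ p)) (splits R)
    ≡⟨ concatMap-cong matching-s∷ (splits R) ⟩
  concatMap (map (map₂ suc) ∘ matching h′ ℓ) (splits R)
    ≡⟨ map-concatMap (map₂ suc) (matching h′ ℓ) (splits R) ⟨
  map (map₂ suc) (concatMap (matching h′ ℓ) (splits R))
    ≡⟨ cong (map (map₂ suc)) ih ⟩
  map (map₂ suc) (map (ℓ ,_) (exits h′ R))
    ≡⟨ trans (sym (map-∘ (exits h′ R))) (map-∘ (exits h′ R)) ⟨
  map (ℓ ,_) (map suc (exits h′ R)) ∎
  where
  matching-s∷ : ∀ p → matching h ℓ (s ∷ proj₁ p , proj₂ p) ≡ map (map₂ suc) (matching h′ ℓ p)
  matching-s∷ (B , C) = trans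
    (cong (λ b → if b ∧ startsWithD C then (ℓ , suc (length B)) ∷ [] else []) (step B))
    (sym (if-float (map (map₂ suc)) (dyckFrom h′ B ∧ startsWithD C)))

concatMap-[] : ∀ {A B : Set} (xs : List A) → concatMap {B = B} (λ _ → []) xs ≡ []
concatMap-[] []       = refl
concatMap-[] (_ ∷ xs) = concatMap-[] xs

concatMap-matching : ∀ h ℓ R → concatMap (matching h ℓ) (splits R) ≡ map (ℓ ,_) (exits h R)
concatMap-matching zero    ℓ []      = refl
concatMap-matching (suc h) ℓ []      = refl
concatMap-matching zero    ℓ (u ∷ R) = matching-∷ 0 1 ℓ u R (λ _ → refl) (concatMap-matching 1 ℓ R)
concatMap-matching (suc h) ℓ (u ∷ R) = matching-∷ (suc h) (suc (suc h)) ℓ u R (λ _ → refl) (concatMap-matching (suc (suc h)) ℓ R)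
concatMap-matching zero    ℓ (d ∷ R) =
  cong ((ℓ , 0) ∷_) (trans (concatMap-map (matching 0 ℓ) _ (splits R)) (concatMap-[] (splits R)))
concatMap-matching (suc h) ℓ (d ∷ R) = matching-∷ (suc h) h ℓ d R (λ _ → refl) (concatMap-matching h ℓ R)

tunnelsAt : Word × Word → List (ℕ × ℕ)
tunnelsAt (A , u ∷ R) = map (length A ,_) (exits 0 R)
tunnelsAt (A , _)     = []

tunnels-splits : ∀ D → tunnels D ≡ concatMap tunnelsAt (splits D)
tunnels-splits D = concatMap-cong
  (λ { (A , u ∷ R) → concatMap-matching 0 (length A) R ; (A , d ∷ R) → refl ; (A , []) → refl })
  (splits D)

shift : ℕ → ℕ × ℕ → ℕ × ℕ
shift L = map₁ (_+_ L)

tunnelsAt-∷ : ∀ s p → tunnelsAt (s ∷ proj₁ p , proj₂ p) ≡ map (shift 1) (tunnelsAt p)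
tunnelsAt-∷ s (A , u ∷ R) = map-∘ (exits 0 R)
tunnelsAt-∷ s (A , d ∷ R) = refl
tunnelsAt-∷ s (A , [])    = refl

tunnels-∷ : ∀ s w → tunnels (s ∷ w) ≡ tunnelsAt ([] , s ∷ w) ++ map (shift 1) (tunnels w)
tunnels-∷ s w = begin
  tunnels (s ∷ w)
    ≡⟨ tunnels-splits (s ∷ w) ⟩
  tunnelsAt ([] , s ∷ w) ++ concatMap tunnelsAt (map (λ p → s ∷ proj₁ p , proj₂ p) (splits w))
    ≡⟨ cong (tunnelsAt ([] , s ∷ w) ++_) (begin
         concatMap tunnelsAt (map (λ p → s ∷ proj₁ p , proj₂ p) (splits w))
           ≡⟨ concatMap-map tunnelsAt _ (splits w) ⟩
         concatMap (λ p → tunnelsAt (s ∷ proj₁ p , proj₂ p)) (splits w)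
           ≡⟨ concatMap-cong (tunnelsAt-∷ s) (splits w) ⟩
         concatMap (map (shift 1) ∘ tunnelsAt) (splits w)
           ≡⟨ map-concatMap (shift 1) tunnelsAt (splits w) ⟨
         map (shift 1) (concatMap tunnelsAt (splits w))
           ≡⟨ cong (map (shift 1)) (tunnels-splits w) ⟨
         map (shift 1) (tunnels w) ∎) ⟩
  tunnelsAt ([] , s ∷ w) ++ map (shift 1) (tunnels w) ∎

map-shift-++ : ∀ L (xs ys : List (ℕ × ℕ)) → map (shift 1) (xs ++ map (shift L) ys) ≡ map (shift 1) xs ++ map (shift (suc L)) ys
map-shift-++ L xs ys = trans (map-++ (shift 1) xs _) (cong (map (shift 1) xs ++_) (sym (map-∘ ys)))

tunnels-++ : ∀ h W B → dyckFrom h W ≡ true → tunnels (W ++ B) ≡ tunnels W ++ map (shift (length W)) (tunnels B)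
tunnels-++ zero    []      B _  = sym (map-id (tunnels B))
tunnels-++ (suc h) []      B ()
tunnels-++ h       (u ∷ W) B dW = begin
  tunnels (u ∷ W ++ B)
    ≡⟨ tunnels-∷ u (W ++ B) ⟩
  map (0 ,_) (exits 0 (W ++ B)) ++ map (shift 1) (tunnels (W ++ B))
    ≡⟨ cong₂ (λ xs ys → map (0 ,_) xs ++ map (shift 1) ys) (exits-++ W B (s≤s z≤n) dW′) (tunnels-++ (suc h) W B dW′) ⟩
  map (0 ,_) (exits 0 W) ++ map (shift 1) (tunnels W ++ map (shift (length W)) (tunnels B))
    ≡⟨ cong (map (0 ,_) (exits 0 W) ++_) (map-shift-++ (length W) (tunnels W) (tunnels B)) ⟩
  map (0 ,_) (exits 0 W) ++ (map (shift 1) (tunnels W) ++ map (shift (length (u ∷ W))) (tunnels B))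
    ≡⟨ ++-assoc (map (0 ,_) (exits 0 W)) _ _ ⟨
  (map (0 ,_) (exits 0 W) ++ map (shift 1) (tunnels W)) ++ map (shift (length (u ∷ W))) (tunnels B)
    ≡⟨ cong (_++ map (shift (length (u ∷ W))) (tunnels B)) (tunnels-∷ u W) ⟨
  tunnels (u ∷ W) ++ map (shift (length (u ∷ W))) (tunnels B) ∎
  where
  dW′ : dyckFrom (suc h) W ≡ true
  dW′ = trans (sym (dyckFrom-u∷ h W)) dW
tunnels-++ zero    (d ∷ W) B ()
tunnels-++ (suc h) (d ∷ W) B dW = begin
  tunnels (d ∷ W ++ B)
    ≡⟨ tunnels-∷ d (W ++ B) ⟩
  map (shift 1) (tunnels (W ++ B))
    ≡⟨ cong (map (shift 1)) (tunnels-++ h W B dW) ⟩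
  map (shift 1) (tunnels W ++ map (shift (length W)) (tunnels B))
    ≡⟨ map-shift-++ (length W) (tunnels W) (tunnels B) ⟩
  map (shift 1) (tunnels W) ++ map (shift (length (d ∷ W))) (tunnels B)
    ≡⟨ cong (_++ map (shift (length (d ∷ W))) (tunnels B)) (tunnels-∷ d W) ⟨
  tunnels (d ∷ W) ++ map (shift (length (d ∷ W))) (tunnels B) ∎

-- Tunnel statistics

ShiftInvariant : (ℤ → ℤ → Bool) → Set
ShiftInvariant R = ∀ x y c → R (x ℤ.+ c) y ≡ R x (y ℤ.- c)

≟-shiftInvariant : ShiftInvariant (λ x y → ⌊ x ℤ.≟ y ⌋)
≟-shiftInvariant x y c = ⌊⌋-⇔ (mk⇔ to from) (x ℤ.+ c ℤ.≟ y) (x ℤ.≟ y ℤ.- c)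
  where
  to : x ℤ.+ c ≡ y → x ≡ y ℤ.- c
  to refl = sym (i+j-j≡i x c)
  from : x ≡ y ℤ.- c → x ℤ.+ c ≡ y
  from refl = i-j+j≡i y c

<-shiftInvariant : ShiftInvariant (λ x y → ⌊ x ℤ.<? y ⌋)
<-shiftInvariant x y c = ⌊⌋-⇔ (mk⇔ to from) (x ℤ.+ c ℤ.<? y) (x ℤ.<? y ℤ.- c)
  where
  to : x ℤ.+ c ℤ.< y → x ℤ.< y ℤ.- c
  to x+c<y = subst (ℤ._< y ℤ.- c) (i+j-j≡i x c) (ℤ.+-monoˡ-< (- c) x+c<y)
  from : x ℤ.< y ℤ.- c → x ℤ.+ c ℤ.< y
  from x<y-c = subst (x ℤ.+ c ℤ.<_) (i-j+j≡i y c) (ℤ.+-monoˡ-< c x<y-c)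

mid2-shift : ∀ L τ → mid2 (shift L τ) ≡ mid2 τ ℤ.+ + (2 * L)
mid2-shift L (a , b) = trans (cong +_ (rearrange L a b)) (ℤ.pos-+ (2 * a + b + 2) (2 * L))
  where
  rearrange : ∀ L a b → 2 * (L + a) + b + 2 ≡ 2 * a + b + 2 + 2 * L
  rearrange = ℕ-Solver.solve-∀

length-filterᵇ-++ : ∀ {A : Set} (P : A → Bool) xs ys →
  length (filterᵇ P (xs ++ ys)) ≡ length (filterᵇ P xs) + length (filterᵇ P ys)
length-filterᵇ-++ P xs ys = trans (cong length (filter-++ (T? ∘ P) xs ys)) (length-++ (filterᵇ P xs))

length-filterᵇ-map : ∀ {A B : Set} {P : B → Bool} {Q : A → Bool} (f : A → B) →
  (∀ x → P (f x) ≡ Q x) → ∀ xs → length (filterᵇ P (map f xs)) ≡ length (filterᵇ Q xs)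
length-filterᵇ-map f e [] = refl
length-filterᵇ-map {P = P} {Q} f e (x ∷ xs) with P (f x) | Q x | e x
... | true  | .true  | refl = cong suc (length-filterᵇ-map f e xs)
... | false | .false | refl = length-filterᵇ-map f e xs

countMid : (ℤ → ℤ → Bool) → ℤ → Word → ℕ
countMid R t D = length (filterᵇ (λ τ → R (mid2 τ) t) (tunnels D))

countMid-++ : ∀ {R} → ShiftInvariant R → ∀ h W B t → dyckFrom h W ≡ true →
  countMid R t (W ++ B) ≡ countMid R t W + countMid R (t ℤ.- + (2 * length W)) B
countMid-++ {R} inv h W B t dW = begin
  length (filterᵇ P (tunnels (W ++ B)))
    ≡⟨ cong (length ∘ filterᵇ P) (tunnels-++ h W B dW) ⟩
  length (filterᵇ P (tunnels W ++ map (shift (length W)) (tunnels B)))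
    ≡⟨ length-filterᵇ-++ P (tunnels W) _ ⟩
  countMid R t W + length (filterᵇ P (map (shift (length W)) (tunnels B)))
    ≡⟨ cong (_+_ (countMid R t W)) (length-filterᵇ-map (shift (length W)) moved (tunnels B)) ⟩
  countMid R t W + countMid R (t ℤ.- + (2 * length W)) B ∎
  where
  P : ℕ × ℕ → Bool
  P τ = R (mid2 τ) t
  moved : ∀ τ → P (shift (length W) τ) ≡ R (mid2 τ) (t ℤ.- + (2 * length W))
  moved τ = trans (cong (λ x → R x t) (mid2-shift (length W) τ)) (inv (mid2 τ) t _)

-- ct = tally (λ x y → ⌊ x ≟ y ⌋) and lt = tally (λ x y → ⌊ x <? y ⌋), definitionally.
tally : (ℤ → ℤ → Bool) → ℕ → ℤ → Word → ℕ
tally R n r = countMid R (+ 2 ℤ.* (+ n ℤ.- r))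

tally-++ : ∀ {R} → ShiftInvariant R → ∀ W B p q r → isDyck W ≡ true → length W ≡ 2 * p →
  tally R (p + q) r (W ++ B) ≡ tally R p (r ℤ.- + q) W + tally R q (r ℤ.+ + p) B
tally-++ {R} inv W B p q r dW ∣W∣ = trans (countMid-++ {R} inv 0 W B (+ 2 ℤ.* (+ (p + q) ℤ.- r)) dW) (cong₂ _+_
  (cong (λ t → countMid R t W) (trans (cong (λ n → + 2 ℤ.* (n ℤ.- r)) (ℤ.pos-+ p q)) (targetW (+ p) (+ q) r)))
  (cong (λ t → countMid R t B) (begin
    + 2 ℤ.* (+ (p + q) ℤ.- r) ℤ.- + (2 * length W)
      ≡⟨ cong₂ (λ n l → + 2 ℤ.* (n ℤ.- r) ℤ.- l) (ℤ.pos-+ p q) 4p ⟩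
    + 2 ℤ.* ((+ p ℤ.+ + q) ℤ.- r) ℤ.- + 2 ℤ.* (+ 2 ℤ.* + p)
      ≡⟨ targetB (+ p) (+ q) r ⟩
    + 2 ℤ.* (+ q ℤ.- (r ℤ.+ + p)) ∎)))
  where
  targetW : ∀ x y r → + 2 ℤ.* ((x ℤ.+ y) ℤ.- r) ≡ + 2 ℤ.* (x ℤ.- (r ℤ.- y))
  targetW = solve-∀
  targetB : ∀ x y r → + 2 ℤ.* ((x ℤ.+ y) ℤ.- r) ℤ.- + 2 ℤ.* (+ 2 ℤ.* x) ≡ + 2 ℤ.* (y ℤ.- (r ℤ.+ x))
  targetB = solve-∀
  4p : + (2 * length W) ≡ + 2 ℤ.* (+ 2 ℤ.* + p)
  4p = trans (cong (λ l → + (2 * l)) ∣W∣) (trans (ℤ.pos-* 2 (2 * p)) (cong (ℤ._*_ (+ 2)) (ℤ.pos-* 2 p)))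

tally-firstReturn : ∀ {R} → ShiftInvariant R → ∀ A B j q m → isDyck A ≡ true → length A ≡ 2 * j →
  tally R (suc j + q) m (u ∷ A ++ d ∷ B) ≡ tally R (suc j) (m ℤ.- + q) (u ∷ A ++ d ∷ []) + tally R q (m ℤ.+ + suc j) B
tally-firstReturn {R} inv A B j q m dA ∣A∣ = trans
  (cong (tally R (suc j + q) m ∘ (u ∷_)) (sym (++-assoc A (d ∷ []) B)))
  (tally-++ {R} inv (u ∷ A ++ d ∷ []) B (suc j) q m (dyckFrom-++ 0 1 A (d ∷ []) dA refl) ∣uAd∣)
  where
  ∣uAd∣ : length (u ∷ A ++ d ∷ []) ≡ 2 * suc j
  ∣uAd∣ = trans (cong suc (trans (length-++ A) (cong (_+ 1) ∣A∣))) (wrap j)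
    where
    wrap : ∀ j → suc (2 * j + 1) ≡ 2 * suc j
    wrap = ℕ-Solver.solve-∀

-- The coefficients of diag P and of H₃

hasStats : ℕ → ℕ → ℕ → ℤ → Word → Bool
hasStats a b n r D = (ct n r D ≡ᵇ a) ∧ (lt n r D ≡ᵇ b)

H₁-count : ∀ a b j {k r} → - + suc j ℤ.≤ k → - k ≡ r →
  H₁ a b k (suc j) ≡ count (λ A → hasStats a b (suc j) r (u ∷ A ++ d ∷ [])) (dyckPaths j)
H₁-count a b j {k} k≥ refl =
  cong (λ g → if g then count (λ A → hasStats a b (suc j) (- k) (u ∷ A ++ d ∷ [])) (dyckPaths j) else 0)
       (⌊⌋-true (- + suc j ℤ.≤? k) k≥)

H₂-count : ∀ a b n {r r′} → - + n ℤ.≤ r′ → r ≡ r′ → H₂ a b r n ≡ count (hasStats a b n r′) (dyckPaths n)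
H₂-count a b n {r′ = r} r≥ refl =
  cong (λ g → if g then count (hasStats a b n r) (dyckPaths n) else 0) (⌊⌋-true (- + n ℤ.≤? r) r≥)

H₃-count : ∀ a b N m → - + suc N ℤ.≤ m → m ℤ.≤ + suc N →
  H₃ a b m (suc N) ≡ count (hasStats a b (suc N) m) (dyckPaths (suc N))
H₃-count a b N m m≥ m≤ =
  cong (λ g → if g then count (hasStats a b (suc N) m) (dyckPaths (suc N)) else 0)
       (cong₂ _∧_ (⌊⌋-true (- + suc N ℤ.≤? m) m≥) (⌊⌋-true (m ℤ.≤? + suc N) m≤))

H₃-out : ∀ a b N m → ¬ (- + suc N ℤ.≤ m × m ℤ.≤ + suc N) → H₃ a b m (suc N) ≡ 0
H₃-out a b N m out with - + suc N ℤ.≤? m | m ℤ.≤? + suc N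
... | yes m≥ | yes m≤ = contradiction (m≥ , m≤) out
... | yes _  | no _   = refl
... | no _   | _      = refl

-p≤q-m⇔m≤p+q : ∀ p q m → (- + p ℤ.≤ + q ℤ.- m) ⇔ (m ℤ.≤ + (p + q))
-p≤q-m⇔m≤p+q p q m = ≤-translate (m ℤ.+ + p) (cancel (+ p) m) (trans (swap (+ p) (+ q) m) (sym (ℤ.pos-+ p q)))
  where
  cancel : ∀ x m → - x ℤ.+ (m ℤ.+ x) ≡ m
  cancel = solve-∀
  swap : ∀ x y m → (y ℤ.- m) ℤ.+ (m ℤ.+ x) ≡ x ℤ.+ y
  swap = solve-∀

q-m≤n+q⇔-n≤m : ∀ n q m → (+ q ℤ.- m ℤ.≤ + n ℤ.+ + q) ⇔ (- + n ℤ.≤ m)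
q-m≤n+q⇔-n≤m n q m = ≤-translate (m ℤ.- + n ℤ.- + q) (lower (+ n) (+ q) m) (upper (+ n) (+ q) m)
  where
  lower : ∀ n y m → (y ℤ.- m) ℤ.+ (m ℤ.- n ℤ.- y) ≡ - n
  lower = solve-∀
  upper : ∀ n y m → (n ℤ.+ y) ℤ.+ (m ℤ.- n ℤ.- y) ≡ m
  upper = solve-∀

diagTerm : ℕ → ℕ → ℕ → ℤ → ℕ → ℕ → ℕ
diagTerm a b n m p q =
  Σℕ a λ a₁ → Σℕ b λ b₁ → Σℤ (- (+ p)) (+ n ℤ.+ + q) λ k →
    H₁ a₁ b₁ k p * H₂ (a ∸ a₁) (b ∸ b₁) (+ n ℤ.- k) q * [ m ≟ℤ (+ q ℤ.- k) ]

-- H₁ has no t⁰ term, so the n₁ = 0 summand vanishes.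
diagP≡∑ : ∀ a b n m → diagP a b n m ≡ ∑ n (λ j → diagTerm a b n m (suc j) (n ∸ suc j))
diagP≡∑ a b n m = trans (Σℕ≡∑ n (λ p → diagTerm a b n m p (n ∸ p)))
  (cong (λ x → x + ∑ n (λ j → diagTerm a b n m (suc j) (n ∸ suc j)))
        (Σℕ-zero a (λ _ → Σℕ-zero b (λ _ → Σℤ-zero (- + 0) (+ n ℤ.+ + n)))))

Σℤ-collapse : ∀ a₁ b₁ a₂ b₂ j q m → - + (suc j + q) ℤ.≤ m → m ℤ.≤ + (suc j + q) →
  Σℤ (- + suc j) (+ (suc j + q) ℤ.+ + q)
     (λ k → H₁ a₁ b₁ k (suc j) * H₂ a₂ b₂ (+ (suc j + q) ℤ.- k) q * [ m ≟ℤ + q ℤ.- k ])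
  ≡ count (λ A → hasStats a₁ b₁ (suc j) (m ℤ.- + q) (u ∷ A ++ d ∷ [])) (dyckPaths j)
    * count (hasStats a₂ b₂ q (m ℤ.+ + suc j)) (dyckPaths q)
Σℤ-collapse a₁ b₁ a₂ b₂ j q m m≥ m≤ = begin
  Σℤ (- + p) (+ n ℤ.+ + q) (λ k → G k * [ m ≟ℤ + q ℤ.- k ])
    ≡⟨ Σℤ-cong (- + p) (+ n ℤ.+ + q) (λ k → cong (_*_ (G k)) ([≟ℤ]-transpose m (+ q) k)) ⟩
  Σℤ (- + p) (+ n ℤ.+ + q) (λ k → G k * [ k ≟ℤ k₀ ])
    ≡⟨ Σℤ-δ G (Equivalence.from (-p≤q-m⇔m≤p+q p q m) m≤) (Equivalence.from (q-m≤n+q⇔-n≤m n q m) m≥) ⟩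
  H₁ a₁ b₁ k₀ p * H₂ a₂ b₂ (+ n ℤ.- k₀) q
    ≡⟨ cong₂ _*_ (H₁-count a₁ b₁ j (Equivalence.from (-p≤q-m⇔m≤p+q p q m) m≤) (neg-k₀ (+ q) m))
                 (H₂-count a₂ b₂ q H₂-window (trans (cong (ℤ._- k₀) (ℤ.pos-+ p q)) (n-k₀ (+ p) (+ q) m))) ⟩
  count (λ A → hasStats a₁ b₁ p (m ℤ.- + q) (u ∷ A ++ d ∷ [])) (dyckPaths j)
    * count (hasStats a₂ b₂ q (m ℤ.+ + p)) (dyckPaths q) ∎
  where
  p n : ℕ
  p = suc j
  n = p + q
  k₀ : ℤ
  k₀ = + q ℤ.- m
  G : ℤ → ℕ
  G k = H₁ a₁ b₁ k p * H₂ a₂ b₂ (+ n ℤ.- k) q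
  neg-k₀ : ∀ y m → - (y ℤ.- m) ≡ m ℤ.- y
  neg-k₀ = solve-∀
  n-k₀ : ∀ x y m → (x ℤ.+ y) ℤ.- (y ℤ.- m) ≡ m ℤ.+ x
  n-k₀ = solve-∀
  H₂-window : - + q ℤ.≤ m ℤ.+ + p
  H₂-window = Equivalence.to (≤-translate (+ p) (trans (cong (λ x → - x ℤ.+ + p) (ℤ.pos-+ p q)) (cancel (+ p) (+ q))) refl) m≥
    where
    cancel : ∀ x y → - (x ℤ.+ y) ℤ.+ x ≡ - y
    cancel = solve-∀

diagTerm-out : ∀ a b {n} p q m → p + q ≡ n → ¬ (- + n ℤ.≤ m × m ℤ.≤ + n) → diagTerm a b n m p q ≡ 0
diagTerm-out a b p q m refl out = Σℕ-zero a λ a₁ → Σℕ-zero b λ b₁ → trans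
  (Σℤ-cong (- + p) (+ (p + q) ℤ.+ + q) (λ k → cong (_*_ (G a₁ b₁ k)) ([≟ℤ]-transpose m (+ q) k)))
  (Σℤ-δ-out (G a₁ b₁) λ (lo≤k₀ , k₀≤hi) →
    out (Equivalence.to (q-m≤n+q⇔-n≤m (p + q) q m) k₀≤hi , Equivalence.to (-p≤q-m⇔m≤p+q p q m) lo≤k₀))
  where
  G : ℕ → ℕ → ℤ → ℕ
  G a₁ b₁ k = H₁ a₁ b₁ k p * H₂ (a ∸ a₁) (b ∸ b₁) (+ (p + q) ℤ.- k) q

diagTerm-in : ∀ a b {n} j q m → suc j + q ≡ n → - + n ℤ.≤ m → m ℤ.≤ + n →
  diagTerm a b n m (suc j) q ≡ ΣPath 0 (2 * j) (λ A → ΣPath 0 (2 * q) (λ B → 𝟙 (hasStats a b n m (u ∷ A ++ d ∷ B))))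
diagTerm-in a b j q m refl m≥ m≤ = begin
  diagTerm a b n m p q
    ≡⟨ Σℕ-cong a (λ a₁ → Σℕ-cong b (λ b₁ → trans (Σℤ-collapse a₁ b₁ (a ∸ a₁) (b ∸ b₁) j q m m≥ m≤)
                                                  (cong₂ _*_ (count-dyckPaths _ j) (count-dyckPaths _ q)))) ⟩
  Σℕ a (λ a₁ → Σℕ b (λ b₁ →
      ΣPath 0 (2 * j) (λ A → 𝟙 ((c₁ A ≡ᵇ a₁) ∧ (l₁ A ≡ᵇ b₁)))
    * ΣPath 0 (2 * q) (λ B → 𝟙 ((c₂ B ≡ᵇ a ∸ a₁) ∧ (l₂ B ≡ᵇ b ∸ b₁)))))
    ≡⟨ ΣPath-convolution a b 0 (2 * j) 0 (2 * q) c₁ l₁ c₂ l₂ ⟩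
  ΣPath 0 (2 * j) (λ A → ΣPath 0 (2 * q) (λ B → 𝟙 ((c₁ A + c₂ B ≡ᵇ a) ∧ (l₁ A + l₂ B ≡ᵇ b))))
    ≡⟨ ΣPath-cong 0 (2 * j) (λ A ∣A∣ dA → ΣPath-cong′ 0 (2 * q) (λ B → cong 𝟙 (sym (split A B dA ∣A∣)))) ⟩
  ΣPath 0 (2 * j) (λ A → ΣPath 0 (2 * q) (λ B → 𝟙 (hasStats a b n m (u ∷ A ++ d ∷ B)))) ∎
  where
  p n : ℕ
  p = suc j
  n = p + q
  c₁ l₁ c₂ l₂ : Word → ℕ
  c₁ A = ct p (m ℤ.- + q) (u ∷ A ++ d ∷ [])
  l₁ A = lt p (m ℤ.- + q) (u ∷ A ++ d ∷ [])
  c₂ B = ct q (m ℤ.+ + p) B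
  l₂ B = lt q (m ℤ.+ + p) B
  split : ∀ A B → isDyck A ≡ true → length A ≡ 2 * j →
    hasStats a b n m (u ∷ A ++ d ∷ B) ≡ ((c₁ A + c₂ B ≡ᵇ a) ∧ (l₁ A + l₂ B ≡ᵇ b))
  split A B dA ∣A∣ = cong₂ (λ x y → (x ≡ᵇ a) ∧ (y ≡ᵇ b))
    (tally-firstReturn {λ x y → ⌊ x ℤ.≟ y ⌋} ≟-shiftInvariant A B j q m dA ∣A∣)
    (tally-firstReturn {λ x y → ⌊ x ℤ.<? y ⌋} <-shiftInvariant A B j q m dA ∣A∣)

lemma1 : (a b n : ℕ) (m : ℤ) → diagP a b n m ≡ H₃ a b m n
lemma1 a b zero    m = diagP≡∑ a b 0 m
lemma1 a b (suc N) m with (- + suc N ℤ.≤? m) ×-dec (m ℤ.≤? + suc N)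
... | no out = begin
  diagP a b (suc N) m                                      ≡⟨ diagP≡∑ a b (suc N) m ⟩
  ∑ (suc N) (λ j → diagTerm a b (suc N) m (suc j) (N ∸ j)) ≡⟨ ∑-zero (suc N) (λ j j<n → diagTerm-out a b (suc j) (N ∸ j) m (ℕ.m+[n∸m]≡n j<n) out) ⟩
  0                                                        ≡⟨ H₃-out a b N m out ⟨
  H₃ a b m (suc N)                                         ∎
... | yes (m≥ , m≤) = begin
  diagP a b (suc N) m
    ≡⟨ diagP≡∑ a b (suc N) m ⟩
  ∑ (suc N) (λ j → diagTerm a b (suc N) m (suc j) (N ∸ j))
    ≡⟨ ∑-cong (suc N) (λ j j<n → diagTerm-in a b j (N ∸ j) m (ℕ.m+[n∸m]≡n j<n) m≥ m≤) ⟩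
  ∑ (suc N) (λ j → ΣPath 0 (2 * j) (λ A → ΣPath 0 (2 * (N ∸ j)) (λ B → 𝟙 (hasStats a b (suc N) m (u ∷ A ++ d ∷ B)))))
    ≡⟨ ΣPath-firstReturn N (𝟙 ∘ hasStats a b (suc N) m) ⟨
  ΣPath 0 (2 * suc N) (𝟙 ∘ hasStats a b (suc N) m)
    ≡⟨ count-dyckPaths (hasStats a b (suc N) m) (suc N) ⟨
  count (hasStats a b (suc N) m) (dyckPaths (suc N))
    ≡⟨ H₃-count a b N m m≥ m≤ ⟨
  H₃ a b m (suc N) ∎
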